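{- Let $\Sigma=\{a<b<c\}$ be an ordered alphabet and let $w\in\Sigma^*$ with $|w|_b=k\ge 3$. Assume every word in $C_w$ is square-free. Write $w=u_0bu_1bu_2\cdots bu_k$ with $u_i\in\{a,c\}^*$ for every $0\le i\le k$. Then $u_i\in\{a,c\}$ for every $1\le i\le k-1$, $u_0,u_k\in\{\lambda,a,c\}$, and $u_i\neq u_{i+1}$ for every $0\le i\le k-1$.
   Context: $\lambda$ denotes the empty word. For words $w,v$, $|w|_v$ is the number of occurrences of $v$ as a scattered subword of $w$ (occurrences counted as distinct position sets). A word is square-free if it has no factor (contiguous subword) of the form $uu$ with $u$ nonempty. The Parikh matrix of $w$ with respect to $a<b<c$ is the $4\times4$ upper triangular matrix with unit diagonal whose entries above the diagonal are: $(1,2)=|w|_a$, $(1,3)=|w|_{ab}$, $(1,4)=|w|_{abc}$, $(2,3)=|w|_b$, $(2,4)=|w|_{bc}$, $(3,4)=|w|_c$. Two words are $M$-equivalent iff they have the same Parikh matrix, and $C_w$ is the set of all words $M$-equivalent to $w$. -}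

module Defs where

open import Data.Nat using (ℕ; zero; suc; _+_)
open import Data.Bool using (Bool; true; false)
open import Data.List using (List; []; _∷_; _++_; [_])
open import Data.Product using (Σ; ∃; _×_; _,_)
open import Relation.Binary.PropositionalEquality using (_≡_)
open import Relation.Nullary using (¬_)

data Letter : Set where
  a b c : Letter

Word : Set
Word = List Letter

_==_ : Letter → Letter → Bool
a == a = true
b == b = true
c == c = true
_ == _ = false

-- |w|_v : number of occurrences of v as a scattered subword of w
-- (standard recursion: |xw|_{yv} = |w|_{yv} + [x = y] |w|_v, |w|_λ = 1)
occ : Word → Word → ℕ
occ w [] = 1
occ [] (_ ∷ _) = 0
occ (x ∷ w) (y ∷ v) with x == y
... | true  = occ w (y ∷ v) + occ w v
... | false = occ w (y ∷ v)

-- Parikh matrix w.r.t. a < b < c, represented by its six entries above the diagonal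
record ParikhMatrix : Set where
  constructor pm
  field
    m12 m13 m14 m23 m24 m34 : ℕ

parikh : Word → ParikhMatrix
parikh w = pm (occ w [ a ]) (occ w (a ∷ b ∷ [])) (occ w (a ∷ b ∷ c ∷ []))
              (occ w [ b ]) (occ w (b ∷ c ∷ [])) (occ w [ c ])

_≡M_ : Word → Word → Set
w ≡M v = parikh w ≡ parikh v

SquareFree : Word → Set
SquareFree w = ∀ (x u y : Word) → ¬ (u ≡ []) → ¬ (w ≡ x ++ (u ++ u) ++ y)

data IsAC : Letter → Set where
  isA : IsAC a
  isC : IsAC c

joinB : List Word → Word
joinB [] = []
joinB (u ∷ []) = u
joinB (u ∷ us@(_ ∷ _)) = u ++ b ∷ joinB us

-- Exchanging adjacent letters a and c changes no entry of the Parikh matrix,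
-- since none of the counted subwords a, b, c, ab, bc, abc has a next to c;
-- hence every word obtained from w by such exchanges is square-free too.
-- Within a block this leaves only λ, a, c, ac and ca (aca becomes aac, cac
-- becomes cca). An inner block is nonempty (else bb), equal neighbours give the
-- square (ub)(ub) or (bu)(bu), and a block ac or ca followed or preceded by
-- b y b, y a nonempty block, rearranges into a square: ca·bab = c(ab)(ab),
-- ac·bacb → (acb)(acb), and so on. As k ≥ 3, every block has two blocks on
-- one side of it.
module Submission where

open import Defs
open import Data.Bool using (true; false)
open import Data.Empty using (⊥-elim)
open import Data.Fin using (Fin; zero; suc; toℕ)
open import Data.List using (List; []; _∷_; [_]; _++_; _∷ʳ_; length; lookup; concatMap; initLast; _∷ʳ′_)
open import Data.List.Properties
  using (++-assoc; ++-identityʳ; ∷ʳ-++; length-++; concatMap-++)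
open import Data.List.Relation.Unary.All using (All; []; _∷_)
open import Data.List.Relation.Unary.All.Properties using (++⁻ʳ)
open import Data.Nat using (ℕ; suc; _+_; _≤_; _<_; s≤s)
open import Data.Nat.Properties using (suc-injective; +-suc; +-identityʳ; <-irrefl)
open import Data.Product using (_×_; _,_; ∃₂)
open import Data.Sum using (_⊎_; inj₁; inj₂)
open import Relation.Nullary using (¬_)
open import Relation.Binary.PropositionalEquality
  using (_≡_; _≢_; refl; sym; trans; cong; cong₂; subst; module ≡-Reasoning)

private
  variable
    x y : Letter
    u v w w' rest : Word
    pre post : List Word

data ACPair : Word → Set where
  ac : ACPair (a ∷ c ∷ [])
  ca : ACPair (c ∷ a ∷ [])

data ShortAC : Word → Set where
  empty  : ShortAC []
  single : IsAC x → ShortAC [ x ]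
  pair   : ACPair u → ShortAC u

infix 4 _∼_

data _∼_ : Word → Word → Set where
  []   : [] ∼ []
  _∷_  : ∀ x → w ∼ w' → x ∷ w ∼ x ∷ w'
  swap : ACPair (x ∷ y ∷ []) → w ∼ w' → x ∷ y ∷ w ∼ y ∷ x ∷ w'

∼-refl : ∀ w → w ∼ w
∼-refl []      = []
∼-refl (x ∷ w) = x ∷ ∼-refl w

∼-++ : ∀ {u u'} → u ∼ u' → w ∼ w' → u ++ w ∼ u' ++ w'
∼-++ []         q = q
∼-++ (x ∷ p)    q = x ∷ ∼-++ p q
∼-++ (swap e p) q = swap e (∼-++ p q)

ACPair∼ac : ACPair u → u ∼ a ∷ c ∷ []
ACPair∼ac ac = ∼-refl _
ACPair∼ac ca = swap ca []

ACPair∼ca : ACPair u → u ∼ c ∷ a ∷ []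
ACPair∼ca ac = swap ac []
ACPair∼ca ca = ∼-refl _

data FactorOfABC : Word → Set where
  ε   : FactorOfABC []
  a   : FactorOfABC [ a ]
  b   : FactorOfABC [ b ]
  c   : FactorOfABC [ c ]
  ab  : FactorOfABC (a ∷ b ∷ [])
  bc  : FactorOfABC (b ∷ c ∷ [])
  abc : FactorOfABC (a ∷ b ∷ c ∷ [])

FactorOfABC-tail : FactorOfABC (x ∷ v) → FactorOfABC v
FactorOfABC-tail a   = ε
FactorOfABC-tail b   = ε
FactorOfABC-tail c   = ε
FactorOfABC-tail ab  = b
FactorOfABC-tail bc  = c
FactorOfABC-tail abc = bc

SameFactorCounts : Word → Word → Set
SameFactorCounts w w' = ∀ {v} → FactorOfABC v → occ w v ≡ occ w' v

sameFactorCounts-∷ : ∀ x → SameFactorCounts w w' → SameFactorCounts (x ∷ w) (x ∷ w')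
sameFactorCounts-∷ x e {[]}    f = refl
sameFactorCounts-∷ x e {y ∷ v} f with x == y
... | true  = cong₂ _+_ (e f) (e (FactorOfABC-tail f))
... | false = e f

ac-ca-sameFactorCounts : ∀ w → SameFactorCounts (a ∷ c ∷ w) (c ∷ a ∷ w)
ac-ca-sameFactorCounts w ε   = refl
ac-ca-sameFactorCounts w a   = refl
ac-ca-sameFactorCounts w b   = refl
ac-ca-sameFactorCounts w c   = refl
ac-ca-sameFactorCounts w ab  = refl
ac-ca-sameFactorCounts w bc  = refl
ac-ca-sameFactorCounts w abc = refl

swap-sameFactorCounts : ACPair (x ∷ y ∷ []) → ∀ w → SameFactorCounts (x ∷ y ∷ w) (y ∷ x ∷ w)
swap-sameFactorCounts ac w f = ac-ca-sameFactorCounts w f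
swap-sameFactorCounts ca w f = sym (ac-ca-sameFactorCounts w f)

∼⇒sameFactorCounts : w ∼ w' → SameFactorCounts w w'
∼⇒sameFactorCounts []                           f = refl
∼⇒sameFactorCounts (x ∷ p)                      f = sameFactorCounts-∷ x (∼⇒sameFactorCounts p) f
∼⇒sameFactorCounts (swap {x} {y} {w' = w'} e p) f =
  trans (sameFactorCounts-∷ x (sameFactorCounts-∷ y (∼⇒sameFactorCounts p)) f)
        (swap-sameFactorCounts e w' f)

sameFactorCounts⇒≡M : SameFactorCounts w w' → w ≡M w'
sameFactorCounts⇒≡M e rewrite e a | e ab | e abc | e b | e bc | e c = refl

∼⇒≡M : w ∼ w' → w ≡M w'
∼⇒≡M p = sameFactorCounts⇒≡M (∼⇒sameFactorCounts p)

∷ʳ-≢-[] : ∀ {ℓ} {A : Set ℓ} (xs : List A) x → xs ∷ʳ x ≢ []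
∷ʳ-≢-[] []      x ()
∷ʳ-≢-[] (_ ∷ _) x ()

SquareFreeUpToSwaps : Word → Set
SquareFreeUpToSwaps w = ∀ {w'} → w ∼ w' → SquareFree w'

≡M-closed⇒squareFreeUpToSwaps : (∀ v → v ≡M w → SquareFree v) → SquareFreeUpToSwaps w
≡M-closed⇒squareFreeUpToSwaps sf p = sf _ (sym (∼⇒≡M p))

squareFreeUpToSwaps-suffix : ∀ X → SquareFreeUpToSwaps (X ++ w) → SquareFreeUpToSwaps w
squareFreeUpToSwaps-suffix X sf p x q y q≢[] refl =
  sf (∼-++ (∼-refl X) p) (X ++ x) q y q≢[] (sym (++-assoc X x _))

square : ∀ x u y → u ≢ [] → ¬ SquareFree (x ++ u ++ u ++ y)
square x u y u≢[] sf = sf x u y u≢[] (cong (x ++_) (sym (++-assoc u u y)))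

equal-or-ACPair : IsAC x → IsAC y → x ≡ y ⊎ ACPair (x ∷ y ∷ [])
equal-or-ACPair isA isA = inj₁ refl
equal-or-ACPair isA isC = inj₂ ac
equal-or-ACPair isC isA = inj₂ ca
equal-or-ACPair isC isC = inj₁ refl

ACPair-alternates : ∀ {z} → ACPair (x ∷ y ∷ []) → ACPair (y ∷ z ∷ []) → z ≡ x
ACPair-alternates ac ca = refl
ACPair-alternates ca ac = refl

All-IsAC⇒ShortAC : All IsAC u → SquareFreeUpToSwaps (u ++ rest) → ShortAC u
All-IsAC⇒ShortAC []       _ = empty
All-IsAC⇒ShortAC (p ∷ []) _ = single p
All-IsAC⇒ShortAC (px ∷ py ∷ ps) sf with equal-or-ACPair px py
... | inj₁ refl = ⊥-elim (square [] [ _ ] _ (λ ()) (sf (∼-refl _)))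
All-IsAC⇒ShortAC (px ∷ py ∷ []) sf | inj₂ xy = pair xy
All-IsAC⇒ShortAC (px ∷ py ∷ pz ∷ ps) sf | inj₂ xy with equal-or-ACPair py pz
... | inj₁ refl = ⊥-elim (square [ _ ] [ _ ] _ (λ ()) (sf (∼-refl _)))
... | inj₂ yz with ACPair-alternates xy yz
...   | refl = ⊥-elim (square [] [ _ ] _ (λ ()) (sf (_ ∷ swap yz (∼-refl _))))

pair-before-block : ACPair u → ShortAC v → v ≢ [] →
                    ¬ SquareFreeUpToSwaps (u ++ b ∷ v ++ b ∷ rest)
pair-before-block p empty        v≢[] _  = v≢[] refl
pair-before-block p (single isA) _    sf =
  square [ c ] (a ∷ b ∷ []) _ (λ ()) (sf (∼-++ (ACPair∼ca p) (∼-refl _)))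
pair-before-block p (single isC) _    sf =
  square [ a ] (c ∷ b ∷ []) _ (λ ()) (sf (∼-++ (ACPair∼ac p) (∼-refl _)))
pair-before-block p (pair q)     _    sf =
  square [] (a ∷ c ∷ b ∷ []) _ (λ ())
    (sf (∼-++ (ACPair∼ac p) (b ∷ ∼-++ (ACPair∼ac q) (∼-refl _))))

block-before-pair : ShortAC v → v ≢ [] → ACPair u →
                    ¬ SquareFreeUpToSwaps (b ∷ v ++ b ∷ u ++ rest)
block-before-pair empty        v≢[] _ _  = v≢[] refl
block-before-pair (single isA) _    p sf =
  square [] (b ∷ a ∷ []) _ (λ ()) (sf (b ∷ a ∷ b ∷ ∼-++ (ACPair∼ac p) (∼-refl _)))
block-before-pair (single isC) _    p sf =
  square [] (b ∷ c ∷ []) _ (λ ()) (sf (b ∷ c ∷ b ∷ ∼-++ (ACPair∼ca p) (∼-refl _)))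
block-before-pair (pair q)     _    p sf =
  square [] (b ∷ a ∷ c ∷ []) _ (λ ())
    (sf (b ∷ ∼-++ (ACPair∼ac q) (b ∷ ∼-++ (ACPair∼ac p) (∼-refl _))))

bSeparated : List Word → Word
bSeparated = concatMap (b ∷_)

joinB-∷ : ∀ u us → joinB (u ∷ us) ≡ u ++ bSeparated us
joinB-∷ u []       = sym (++-identityʳ u)
joinB-∷ u (v ∷ us) = cong (λ t → u ++ b ∷ t) (joinB-∷ v us)

joinB-split : ∀ p pre u post →
              joinB (p ∷ pre ++ u ∷ post) ≡ (p ++ bSeparated pre) ++ b ∷ u ++ bSeparated post
joinB-split p pre u post = begin
  joinB (p ∷ pre ++ u ∷ post)                       ≡⟨ joinB-∷ p (pre ++ u ∷ post) ⟩
  p ++ bSeparated (pre ++ u ∷ post)                 ≡⟨ cong (p ++_) (concatMap-++ (b ∷_) pre (u ∷ post)) ⟩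
  p ++ bSeparated pre ++ b ∷ u ++ bSeparated post   ≡⟨ ++-assoc p (bSeparated pre) _ ⟨
  (p ++ bSeparated pre) ++ b ∷ u ++ bSeparated post ∎
  where open ≡-Reasoning

lookup-split : ∀ {ℓ} {A : Set ℓ} (xs : List A) (i : Fin (length xs)) →
               ∃₂ λ pre post → xs ≡ pre ++ lookup xs i ∷ post × length pre ≡ toℕ i
lookup-split (x ∷ xs) zero    = [] , xs , refl , refl
lookup-split (x ∷ xs) (suc i) =
  let pre , post , e , l = lookup-split xs i in x ∷ pre , post , cong (x ∷_) e , cong suc l

lookup-split₂ : ∀ {ℓ} {A : Set ℓ} (xs : List A) (i j : Fin (length xs)) → toℕ j ≡ suc (toℕ i) →
                ∃₂ λ pre post → xs ≡ pre ++ lookup xs i ∷ lookup xs j ∷ post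
lookup-split₂ (x ∷ y ∷ xs) zero    (suc zero) refl = [] , xs , refl
lookup-split₂ (x ∷ xs)     (suc i) (suc j)    j≡1+i =
  let pre , post , e = lookup-split₂ xs i j (suc-injective j≡1+i) in x ∷ pre , post , cong (x ∷_) e

module Blocks {us : List Word} {k : ℕ}
              (sf : SquareFreeUpToSwaps (joinB us)) (isAC : All (All IsAC) us)
              (len : length us ≡ suc k) (3≤k : 3 ≤ k) where

  suffix-at-separator : ∀ pre → us ≡ pre ++ u ∷ post → pre ≢ [] →
                        SquareFreeUpToSwaps (b ∷ u ++ bSeparated post)
  suffix-at-separator []                       _    []≢[] = ⊥-elim ([]≢[] refl)
  suffix-at-separator {u} {post} (p ∷ pre)     refl _     =
    squareFreeUpToSwaps-suffix (p ++ bSeparated pre)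
      (subst SquareFreeUpToSwaps (joinB-split p pre u post) sf)

  suffix-at-block : ∀ pre → us ≡ pre ++ u ∷ post → SquareFreeUpToSwaps (u ++ bSeparated post)
  suffix-at-block {u} {post} []        refl = subst SquareFreeUpToSwaps (joinB-∷ u post) sf
  suffix-at-block            (p ∷ pre) e    =
    squareFreeUpToSwaps-suffix [ b ] (suffix-at-separator (p ∷ pre) e (λ ()))

  block-shortAC : ∀ pre → us ≡ pre ++ u ∷ post → ShortAC u
  block-shortAC pre e with ++⁻ʳ pre (subst (All (All IsAC)) e isAC)
  ... | u-isAC ∷ _ = All-IsAC⇒ShortAC u-isAC (suffix-at-block pre e)

  inner-nonempty : ∀ pre → us ≡ pre ++ u ∷ v ∷ post → pre ≢ [] → u ≢ []
  inner-nonempty pre e pre≢[] refl =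
    square [] [ b ] _ (λ ()) (suffix-at-separator pre e pre≢[] (∼-refl _))

  blocks-around : ∀ pre → us ≡ pre ++ u ∷ post → length pre + length post ≡ k
  blocks-around {u} {post} pre e = suc-injective (begin
    suc (length pre + length post)  ≡⟨ +-suc (length pre) (length post) ⟨
    length pre + length (u ∷ post)  ≡⟨ length-++ pre ⟨
    length (pre ++ u ∷ post)        ≡⟨ cong length e ⟨
    length us                       ≡⟨ len ⟩
    suc k                           ∎)
    where open ≡-Reasoning

  three-around : ∀ pre post → us ≡ pre ++ u ∷ post → 3 ≤ length pre + length post
  three-around pre _ e = subst (3 ≤_) (sym (blocks-around pre e)) 3≤k

  ACPair-before-two-blocks : ∀ pre → us ≡ pre ++ u ∷ v ∷ w ∷ post → ¬ ACPair u
  ACPair-before-two-blocks {u} {v} {w} {post} pre e p =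
    pair-before-block p (block-shortAC (pre ∷ʳ u) e′)
      (inner-nonempty (pre ∷ʳ u) e′ (∷ʳ-≢-[] pre u)) (suffix-at-block pre e)
    where
    e′ : us ≡ (pre ∷ʳ u) ++ v ∷ w ∷ post
    e′ = trans e (sym (∷ʳ-++ pre u _))

  ACPair-after-inner-block : ∀ pre → us ≡ pre ++ v ∷ u ∷ post → pre ≢ [] → ¬ ACPair u
  ACPair-after-inner-block pre e pre≢[] p =
    block-before-pair (block-shortAC pre e) (inner-nonempty pre e pre≢[]) p
      (suffix-at-separator pre e pre≢[])

  ACPair-after-two-blocks : ∀ p pre → us ≡ (p ∷ pre) ++ u ∷ post → pre ≢ [] → ¬ ACPair u
  ACPair-after-two-blocks {u} {post} p pre e pre≢[] with pre | initLast pre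
  ... | .[]        | []       = ⊥-elim (pre≢[] refl)
  ... | .(ys ∷ʳ v) | ys ∷ʳ′ v =
    ACPair-after-inner-block (p ∷ ys) (trans e (∷ʳ-++ (p ∷ ys) v (u ∷ post))) (λ ())

  block-not-ACPair : ∀ pre → us ≡ pre ++ u ∷ post → ¬ ACPair u
  block-not-ACPair {post = _ ∷ _ ∷ _} pre            e = ACPair-before-two-blocks pre e
  block-not-ACPair                    (p ∷ p′ ∷ pre) e =
    ACPair-after-two-blocks p (p′ ∷ pre) e (λ ())
  block-not-ACPair {post = []}        []             e with three-around [] [] e
  ... | ()
  block-not-ACPair {post = q ∷ []}    []             e with three-around [] [ q ] e
  ... | s≤s ()
  block-not-ACPair {post = []}        (p ∷ [])       e with three-around [ p ] [] e
  ... | s≤s ()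
  block-not-ACPair {post = q ∷ []}    (p ∷ [])       e with three-around [ p ] [ q ] e
  ... | s≤s (s≤s ())

  block-short : ∀ pre → us ≡ pre ++ u ∷ post → u ≡ [] ⊎ u ≡ [ a ] ⊎ u ≡ [ c ]
  block-short pre e with block-shortAC pre e
  ... | empty      = inj₁ refl
  ... | single isA = inj₂ (inj₁ refl)
  ... | single isC = inj₂ (inj₂ refl)
  ... | pair p     = ⊥-elim (block-not-ACPair pre e p)

  inner-block-single : ∀ pre → us ≡ pre ++ u ∷ post → 1 ≤ length pre → length pre < k →
                       u ≡ [ a ] ⊎ u ≡ [ c ]
  inner-block-single                []        e ()
  inner-block-single {post = []}    (p ∷ pre) e _ pre<k =
    ⊥-elim (<-irrefl (trans (sym (+-identityʳ _)) (blocks-around (p ∷ pre) e)) pre<k)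
  inner-block-single {post = _ ∷ _} (p ∷ pre) e _ _ with block-short (p ∷ pre) e
  ... | inj₁ u≡[]       = ⊥-elim (inner-nonempty (p ∷ pre) e (λ ()) u≡[])
  ... | inj₂ u≡a-or-u≡c = u≡a-or-u≡c

  adjacent-distinct : ∀ pre → us ≡ pre ++ v ∷ w ∷ post → v ≢ w
  adjacent-distinct {v} {post = _ ∷ _} pre e refl =
    square [] (v ∷ʳ b) _ (∷ʳ-≢-[] v b)
      (subst SquareFree doubled (suffix-at-block pre e (∼-refl _)))
    where
    doubled : ∀ {r} → v ++ b ∷ v ++ b ∷ r ≡ (v ∷ʳ b) ++ (v ∷ʳ b) ++ r
    doubled {r} = sym (trans (∷ʳ-++ v b _) (cong (λ t → v ++ b ∷ t) (∷ʳ-++ v b r)))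
  adjacent-distinct {v} {post = []} (p ∷ pre) e refl =
    square [] (b ∷ v) [] (λ ()) (suffix-at-separator (p ∷ pre) e (λ ()) (∼-refl _))
  adjacent-distinct {v} {post = []} [] e refl with three-around [] [ v ] e
  ... | s≤s ()

lemma4p1 : (w : Word) (k : ℕ) → occ w [ b ] ≡ k → 3 ≤ k →
    (∀ v → v ≡M w → SquareFree v) →
    (us : List Word) → length us ≡ suc k → All (All IsAC) us → w ≡ joinB us →
    (∀ (i : Fin (length us)) → 1 ≤ toℕ i → toℕ i < k →
       (lookup us i ≡ [ a ] ⊎ lookup us i ≡ [ c ]))
    × (∀ (i : Fin (length us)) → (toℕ i ≡ 0 ⊎ toℕ i ≡ k) →
       (lookup us i ≡ [] ⊎ lookup us i ≡ [ a ] ⊎ lookup us i ≡ [ c ]))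
    × (∀ (i : Fin (length us)) (j : Fin (length us)) → toℕ j ≡ suc (toℕ i) →
       lookup us i ≢ lookup us j)
lemma4p1 w k _ 3≤k sf us len isAC w≡ =
    (λ i 1≤i i<k → let pre , _ , e , l = lookup-split us i in
       inner-block-single pre e (subst (1 ≤_) (sym l) 1≤i) (subst (_< k) (sym l) i<k))
  , (λ i _ → let pre , _ , e , _ = lookup-split us i in block-short pre e)
  , (λ i j j≡1+i → let pre , _ , e = lookup-split₂ us i j j≡1+i in adjacent-distinct pre e)
  where
  open Blocks (subst SquareFreeUpToSwaps w≡ (≡M-closed⇒squareFreeUpToSwaps sf)) isAC len 3≤k
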